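{- Let $Q$ be an orbit-finite equivariant set with the integer atoms, let $\Phi=(\sim,\mathrm{diff},\mathrm{char})$ be an equivalence signature on $Q$, and let $f:Q\to Q$ be a function. Then $\equiv_\Phi$ is a congruence with respect to $f$ (i.e.\ $p\equiv_\Phi q$ implies $f(p)\equiv_\Phi f(q)$) if and only if (1) for every orbit $\tau$ and all $i\in\mathbb{Z}$: $f(\tau,i)\equiv_\Phi f(\tau,i+\mathrm{char}(\tau))$, and (2) for all orbits $\tau\sim\sigma$ and all $i\in\mathbb{Z}$: $f(\tau,i)\equiv_\Phi f(\sigma,i+\mathrm{diff}(\tau,\sigma))$.
   Context: Integer atoms: atoms are $\mathbb{Z}$ with successor; automorphisms are translations $x\mapsto x+z$. Equivariant = invariant under all translations; orbit-finite = finite union of orbits. For $k\ge1$, $\mathbb{Z}_k$ is the integers mod $k$ with translations acting by addition, $\mathbb{Z}_0=\mathbb{Z}$; each orbit $\tau$ of $Q$ is equivariantly isomorphic to $\mathbb{Z}_{k_\tau}$ for a unique $k_\tau$; fix such isomorphisms and write $(\tau,i)$ for the image of $i\bmod k_\tau$, so $f(\tau,i)$ means $f((\tau,i))$. An equivalence signature is a triple $(\sim,\mathrm{diff},\mathrm{char})$: $\sim$ an equivalence on orbits of $Q$, $\mathrm{diff}(\tau,\sigma)\in\mathbb{Z}$ for $\tau\sim\sigma$, $\mathrm{char}(\Sigma)\in\mathbb{N}$ for each class $\Sigma$ (write $\mathrm{char}(\tau)=\mathrm{char}(\Sigma)$ for $\tau\in\Sigma$), such that $\mathrm{diff}(\tau_1,\tau_2)+\mathrm{diff}(\tau_2,\tau_3)\equiv\mathrm{diff}(\tau_1,\tau_3)\pmod{\mathrm{char}(\Sigma)}$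 for $\tau_i\in\Sigma$ and $k_\tau\equiv0\pmod{\mathrm{char}(\Sigma)}$ for $\tau\in\Sigma$ (mod $0$ means equality). $\equiv_\Phi$ is the smallest equivalence relation on $Q$ containing all pairs $((\tau,i),(\tau,i+\mathrm{char}(\tau)))$ and $((\tau,i),(\sigma,i+\mathrm{diff}(\tau,\sigma)))$ for $i\in\mathbb{Z}$ and $\tau\sim\sigma$. -}

module Defs where

open import Data.Nat as ℕ using (ℕ; zero; suc)
open import Data.Integer as ℤ using (ℤ; +_; _+_; _-_)
open import Data.Integer.DivMod using (_%ℕ_; n%ℕd<d)
open import Data.Integer.Divisibility as ℤD using ()
open import Data.Nat.Divisibility as ℕD using ()
open import Data.Fin using (Fin; fromℕ<)
open import Data.Product using (Σ; _,_)
open import Relation.Binary.Core using (Rel)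
open import Relation.Binary.Structures using (IsEquivalence)
open import Relation.Binary.PropositionalEquality using (_≡_)

-- ℤ_k : the integers mod k, with ℤ_0 = ℤ.
Zmod : ℕ → Set
Zmod zero    = ℤ
Zmod (suc k) = Fin (suc k)

[_]_ : ℤ → (k : ℕ) → Zmod k
[ i ] zero  = i
[ i ] suc k = fromℕ< (n%ℕd<d i (suc k))

-- An orbit-finite equivariant set over the integer atoms with n orbits,
-- the orbit τ being (equivariantly) ℤ_{k τ}.  Elements are pairs (τ , i).
Q : (n : ℕ) → (Fin n → ℕ) → Set
Q n k = Σ (Fin n) (λ τ → Zmod (k τ))

elt : {n : ℕ} (k : Fin n → ℕ) → (τ : Fin n) → ℤ → Q n k
elt k τ i = τ , [ i ] (k τ)

-- Equivalence signature on Q n k.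
-- char is given on orbits but required to be constant on ∼-classes
-- (i.e. it is a function on classes); diff is only meaningful on ∼-related pairs.
record EquivSignature (n : ℕ) (k : Fin n → ℕ) : Set₁ where
  field
    _∼_      : Rel (Fin n) _
    ∼-equiv  : IsEquivalence _∼_
    diff     : Fin n → Fin n → ℤ
    char     : Fin n → ℕ
    char-cls : ∀ {τ σ} → τ ∼ σ → char τ ≡ char σ
    cocycle  : ∀ {τ₁ τ₂ τ₃} → τ₁ ∼ τ₂ → τ₂ ∼ τ₃ → τ₁ ∼ τ₃ →
               (+ char τ₁) ℤD.∣ ((diff τ₁ τ₂ + diff τ₂ τ₃) - diff τ₁ τ₃)
    char∣k   : ∀ τ → char τ ℕD.∣ k τ

module _ {n : ℕ} {k : Fin n → ℕ} (Φ : EquivSignature n k) where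
  open EquivSignature Φ

  data _≡Φ_ : Q n k → Q n k → Set where
    gen-char : ∀ τ i → elt k τ i ≡Φ elt k τ (i + + char τ)
    gen-diff : ∀ {τ σ} → τ ∼ σ → ∀ i → elt k τ i ≡Φ elt k σ (i + diff τ σ)
    ≡Φ-refl  : ∀ {p} → p ≡Φ p
    ≡Φ-sym   : ∀ {p q} → p ≡Φ q → q ≡Φ p
    ≡Φ-trans : ∀ {p q r} → p ≡Φ q → q ≡Φ r → p ≡Φ r

module Submission where

-- ≡Φ is by definition the smallest equivalence relation containing the
-- generating pairs ((τ,i),(τ,i+char τ)) and ((τ,i),(σ,i+diff(τ,σ))).
-- Its induction principle (≡Φ-least) says exactly that: every equivalence
-- relation containing the generators contains ≡Φ.
--
-- Lemma 7 follows by applying this to the pulled-back relation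
--   p ≈ q  :⇔  f p ≡Φ f q,
-- which is always an equivalence relation (pullback-isEquivalence).
-- Conditions (1) and (2) say precisely that it contains the generators, so
-- f is a congruence; conversely a congruence respects in particular the
-- generating pairs, which gives (1) and (2).

open import Defs
open import Data.Nat using (ℕ)
open import Data.Integer using (ℤ; +_; _+_)
open import Data.Fin using (Fin)
open import Data.Product using (_×_; _,_)
open import Function.Bundles using (_⇔_; mk⇔)
open import Level using (0ℓ)
open import Relation.Binary.Core using (Rel)
open import Relation.Binary.Structures using (IsEquivalence)

module _ {n : ℕ} {k : Fin n → ℕ} (Φ : EquivSignature n k) where
  open EquivSignature Φ

  ContainsGenerators : Rel (Q n k) 0ℓ → Set
  ContainsGenerators R =
    (∀ τ i → R (elt k τ i) (elt k τ (i + + char τ))) ×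
    (∀ τ σ → τ ∼ σ → ∀ i → R (elt k τ i) (elt k σ (i + diff τ σ)))

  ≡Φ-least : (R : Rel (Q n k) 0ℓ) → IsEquivalence R → ContainsGenerators R →
             ∀ {p q} → _≡Φ_ Φ p q → R p q
  ≡Φ-least R isEq (char-gen , diff-gen) = go
    where
    open IsEquivalence isEq
    go : ∀ {p q} → _≡Φ_ Φ p q → R p q
    go (gen-char τ i)         = char-gen τ i
    go (gen-diff {τ} {σ} r i) = diff-gen τ σ r i
    go ≡Φ-refl                = refl
    go (≡Φ-sym x)             = sym (go x)
    go (≡Φ-trans x y)         = trans (go x) (go y)

pullback-isEquivalence : ∀ {A B : Set} {R : Rel B 0ℓ} (f : A → B) →
                         IsEquivalence R → IsEquivalence (λ x y → R (f x) (f y))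
pullback-isEquivalence f isEq = record { refl = refl ; sym = sym ; trans = trans }
  where open IsEquivalence isEq

≡Φ-isEquivalence : ∀ {n} {k : Fin n → ℕ} (Φ : EquivSignature n k) →
                   IsEquivalence (_≡Φ_ Φ)
≡Φ-isEquivalence Φ = record { refl = ≡Φ-refl ; sym = ≡Φ-sym ; trans = ≡Φ-trans }

lemma7 : (n : ℕ) (k : Fin n → ℕ) (Φ : EquivSignature n k) (f : Q n k → Q n k) →
    ((∀ p q → _≡Φ_ Φ p q → _≡Φ_ Φ (f p) (f q))
    ⇔
    ((∀ τ (i : ℤ) → _≡Φ_ Φ (f (elt k τ i)) (f (elt k τ (i + + EquivSignature.char Φ τ))))
    ×
    (∀ τ σ → EquivSignature._∼_ Φ τ σ → ∀ (i : ℤ) →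
    _≡Φ_ Φ (f (elt k τ i)) (f (elt k σ (i + EquivSignature.diff Φ τ σ))))))
lemma7 n k Φ f = mk⇔ congruence⇒generators generators⇒congruence
  where
  pulledBack : Rel (Q n k) 0ℓ
  pulledBack p q = _≡Φ_ Φ (f p) (f q)

  congruence⇒generators : (∀ p q → _≡Φ_ Φ p q → pulledBack p q) →
                          ContainsGenerators Φ pulledBack
  congruence⇒generators respects =
    (λ τ i → respects _ _ (gen-char τ i)) , (λ τ σ r i → respects _ _ (gen-diff r i))

  generators⇒congruence : ContainsGenerators Φ pulledBack →
                          ∀ p q → _≡Φ_ Φ p q → pulledBack p q
  generators⇒congruence gens p q =
    ≡Φ-least Φ pulledBack (pullback-isEquivalence f (≡Φ-isEquivalence Φ)) gens
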